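{- Let $q\ge2$ be a prime power and $d$ a positive integer. Then (1) $\displaystyle\sum_{1\le n\le q^d-2,\ n\equiv 0 \bmod q-1}\Bigl[\frac{l(n)}{q-1}\Bigr]=\frac d2\Bigl(\frac{q^d-1}{q-1}-1\Bigr)$; (2) $\displaystyle\sum_{1\le n\le q^d-2,\ n\not\equiv 0 \bmod q-1}\Bigl[\frac{l(n)}{q-1}\Bigr]=\frac{(d-1)(q-2)(q^d-1)}{2(q-1)}$.
   Context: For $n=a_0+a_1q+\cdots+a_{d-1}q^{d-1}$ with $0\le a_i\le q-1$, $l(n)=a_0+\cdots+a_{d-1}$. $[x]$ is the greatest integer $\le x$. -}

module Defs where

open import Data.Nat using (ℕ; zero; suc; _+_; _*_; _∸_; _^_; _≤_; NonZero)
open import Data.Nat.DivMod using (_/_; _%_)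
open import Data.Nat.Primality using (Prime)
open import Data.Product using (∃-syntax; _×_)
open import Data.Bool using (Bool; if_then_else_)
open import Relation.Binary.PropositionalEquality using (_≡_)

IsPrimePower : ℕ → Set
IsPrimePower q = ∃[ p ] ∃[ k ] (Prime p × 1 ≤ k × q ≡ p ^ k)

-- base-q digit sum with fuel; once the fuel is ≥ the number of base-q digits
-- of n this equals l(n) (extra fuel only adds digits 0).
digitSumFuel : (q : ℕ) → .{{NonZero q}} → ℕ → ℕ → ℕ
digitSumFuel q zero    n = 0
digitSumFuel q (suc f) n = n % q + digitSumFuel q f (n / q)

-- l(n) = a_0 + ... + a_{d-1}, the sum of base-q digits of n
-- (fuel n suffices: n has at most n base-q digits when q ≥ 2)
l : (q : ℕ) → .{{NonZero q}} → ℕ → ℕ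
l q n = digitSumFuel q n n

sumFilt : (ℕ → Bool) → (ℕ → ℕ) → ℕ → ℕ
sumFilt P f zero    = 0
sumFilt P f (suc N) = sumFilt P f N + (if P (suc N) then f (suc N) else 0)

{-# OPTIONS --safe #-}
-- Pair n with its base-q complement n' = q^d - 1 - n, whose digits are q - 1 minus those of n,
-- so l(n) + l(n') = d(q - 1).  As l(n) ≡ n (mod q - 1) and q^d - 1 ≡ 0 (mod q - 1), either both
-- n and n' are multiples of q - 1 and their floors [l/(q-1)] add up to d, or neither is and the
-- floors add up to d - 1.  Summing over the pairs, twice each sum is d (resp. d - 1) times the
-- number of n ≤ q^d - 2 in the residue class considered, which is the stated value.
module Submission where

open import Defs
open import Data.Nat
open import Data.Nat.Properties
open import Data.Nat.DivMod
open import Data.Bool using (Bool; true; false; not; if_then_else_)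
open import Data.Product using (_×_; _,_; ∃-syntax)
open import Data.Sum using (_⊎_; inj₁; inj₂)
open import Function using (_∘_)
open import Algebra.Properties.CommutativeSemigroup +-commutativeSemigroup using () renaming (interchange to +-interchange)
open import Relation.Binary.PropositionalEquality
open import Relation.Nullary using (contradiction)
open import Data.Nat.Solver using (module +-*-Solver)
open +-*-Solver using (solve; _:+_; _:*_; _:=_; con)

sumTo : (ℕ → ℕ) → ℕ → ℕ
sumTo g zero    = 0
sumTo g (suc N) = sumTo g N + g (suc N)

sumFilt≡sumTo : ∀ P f N → sumFilt P f N ≡ sumTo (λ n → if P n then f n else 0) N
sumFilt≡sumTo P f zero    = refl
sumFilt≡sumTo P f (suc N) = cong (_+ (if P (suc N) then f (suc N) else 0)) (sumFilt≡sumTo P f N)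

sumTo-cong : ∀ {g h} N → (∀ {n} → 1 ≤ n → n ≤ N → g n ≡ h n) → sumTo g N ≡ sumTo h N
sumTo-cong zero    g≗h = refl
sumTo-cong (suc N) g≗h = cong₂ _+_ (sumTo-cong N (λ 1≤n n≤N → g≗h 1≤n (m≤n⇒m≤1+n n≤N)))
                                   (g≗h (s≤s z≤n) ≤-refl)

sumTo-+ : ∀ g h N → sumTo g N + sumTo h N ≡ sumTo (λ n → g n + h n) N
sumTo-+ g h zero    = refl
sumTo-+ g h (suc N) = trans (+-interchange (sumTo g N) (g (suc N)) (sumTo h N) (h (suc N)))
                            (cong (_+ (g (suc N) + h (suc N))) (sumTo-+ g h N))

sumTo-suc : ∀ g N → sumTo g (suc N) ≡ g 1 + sumTo (g ∘ suc) N
sumTo-suc g zero    = +-comm 0 (g 1)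
sumTo-suc g (suc N) = trans (cong (_+ g (suc (suc N))) (sumTo-suc g N)) (+-assoc (g 1) _ _)

sumTo-reverse : ∀ g N → sumTo g N ≡ sumTo (λ n → g (suc N ∸ n)) N
sumTo-reverse g zero    = refl
sumTo-reverse g (suc N) = begin
  sumTo g (suc N)                                ≡⟨ sumTo-suc g N ⟩
  g 1 + sumTo (g ∘ suc) N                        ≡⟨ cong (g 1 +_) (sumTo-reverse (g ∘ suc) N) ⟩
  g 1 + sumTo (λ n → g (suc (suc N ∸ n))) N      ≡⟨ +-comm (g 1) _ ⟩
  sumTo (λ n → g (suc (suc N ∸ n))) N + g 1      ≡⟨ cong₂ _+_ (sumTo-cong N middle)
                                                             (cong g (sym (m+n∸n≡m 1 N))) ⟩
  sumTo (λ n → g (suc (suc N) ∸ n)) N + g (suc (suc N) ∸ suc N) ∎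
  where
  open ≡-Reasoning
  middle : ∀ {n} → 1 ≤ n → n ≤ N → g (suc (suc N ∸ n)) ≡ g (suc (suc N) ∸ n)
  middle _ n≤N = cong g (sym (+-∸-assoc 1 (m≤n⇒m≤1+n n≤N)))

sumTo-pairing : ∀ g h N → (∀ {n} → 1 ≤ n → n ≤ N → g n + g (suc N ∸ n) ≡ h n) →
                2 * sumTo g N ≡ sumTo h N
sumTo-pairing g h N pair = begin
  sumTo g N + (sumTo g N + 0)                     ≡⟨ cong (sumTo g N +_) (+-identityʳ _) ⟩
  sumTo g N + sumTo g N                           ≡⟨ cong (sumTo g N +_) (sumTo-reverse g N) ⟩
  sumTo g N + sumTo (λ n → g (suc N ∸ n)) N       ≡⟨ sumTo-+ g _ N ⟩
  sumTo (λ n → g n + g (suc N ∸ n)) N             ≡⟨ sumTo-cong N pair ⟩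
  sumTo h N                                       ∎
  where open ≡-Reasoning

carry : ∀ p .{{_ : NonZero p}} {w s Q} → w < p + p → w + s * p ≡ Q * p →
        (w ≡ 0 × s ≡ Q) ⊎ (w ≡ p × suc s ≡ Q)
carry p {w} {s} {Q} w<2p eq = split (w / p) w≡[w/p]*p (m<n*o⇒m/o<n w<2*p)
  where
  w%p≡0 : w % p ≡ 0
  w%p≡0 = trans (sym ([m+kn]%n≡m%n w s p)) (trans (cong (_% p) eq) (m*n%n≡0 Q p))
  w≡[w/p]*p : w ≡ (w / p) * p
  w≡[w/p]*p = trans (m≡m%n+[m/n]*n w p) (cong (_+ (w / p) * p) w%p≡0)
  w<2*p : w < 2 * p
  w<2*p = subst (w <_) (cong (p +_) (sym (+-identityʳ p))) w<2p
  split : ∀ t → w ≡ t * p → t < 2 → (w ≡ 0 × s ≡ Q) ⊎ (w ≡ p × suc s ≡ Q)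
  split 0 w≡0 _ = inj₁ (w≡0 , *-cancelʳ-≡ s Q p (subst (λ z → z + s * p ≡ Q * p) w≡0 eq))
  split 1 w≡p _ = inj₂ (w≡p′ , *-cancelʳ-≡ (suc s) Q p (subst (λ z → z + s * p ≡ Q * p) w≡p′ eq))
    where w≡p′ = trans w≡p (+-identityʳ p)
  split (suc (suc t)) _ (s≤s (s≤s ()))

n≢0⇒n≡ᵇ0≡false : ∀ {n} → n ≢ 0 → (n ≡ᵇ 0) ≡ false
n≢0⇒n≡ᵇ0≡false {zero}  n≢0 = contradiction refl n≢0
n≢0⇒n≡ᵇ0≡false {suc n} _   = refl

m+n≡o⇒n<o⇒m≢0 : ∀ {m n o} → m + n ≡ o → n < o → m ≢ 0
m+n≡o⇒n<o⇒m≢0 n≡o n<o refl = <-irrefl n≡o n<o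

floor-sum-split : ∀ k .{{_ : NonZero k}} {d x y} → x + y ≡ d * k →
  (x % k ≡ᵇ 0) ≡ (y % k ≡ᵇ 0) × x / k + y / k ≡ (if x % k ≡ᵇ 0 then d else d ∸ 1)
floor-sum-split k {d} {x} {y} x+y≡dk with carry k remainders<2k digits
  where
  remainders<2k : x % k + y % k < k + k
  remainders<2k = +-mono-< (m%n<n x k) (m%n<n y k)
  digits : (x % k + y % k) + (x / k + y / k) * k ≡ d * k
  digits = trans (solve 5 (λ a b u v z → (a :+ b) :+ (u :+ v) :* z := (a :+ u :* z) :+ (b :+ v :* z))
                          refl (x % k) (y % k) (x / k) (y / k) k)
                 (trans (cong₂ _+_ (sym (m≡m%n+[m/n]*n x k)) (sym (m≡m%n+[m/n]*n y k))) x+y≡dk)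
... | inj₁ (r+s≡0 , e) rewrite m+n≡0⇒m≡0 (x % k) r+s≡0 | m+n≡0⇒n≡0 (x % k) r+s≡0 = refl , e
... | inj₂ (r+s≡k , e)
  rewrite n≢0⇒n≡ᵇ0≡false (m+n≡o⇒n<o⇒m≢0 r+s≡k (m%n<n y k))
        | n≢0⇒n≡ᵇ0≡false (m+n≡o⇒n<o⇒m≢0 (trans (+-comm (y % k) (x % k)) r+s≡k) (m%n<n x k))
        = refl , cong (_∸ 1) e

sumFilt-pairing : ∀ P f g N →
  (∀ {n} → 1 ≤ n → n ≤ N → (if P n then f n else 0) + (if P (suc N ∸ n) then f (suc N ∸ n) else 0)
                            ≡ (if P n then g n else 0)) →
  2 * sumFilt P f N ≡ sumFilt P g N
sumFilt-pairing P f g N pair = begin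
  2 * sumFilt P f N                          ≡⟨ cong (2 *_) (sumFilt≡sumTo P f N) ⟩
  2 * sumTo (λ n → if P n then f n else 0) N ≡⟨ sumTo-pairing _ _ N pair ⟩
  sumTo (λ n → if P n then g n else 0) N     ≡⟨ sym (sumFilt≡sumTo P g N) ⟩
  sumFilt P g N                              ∎
  where open ≡-Reasoning

pair-sum-if : ∀ {a b x y s t} → b ≡ a × x + y ≡ (if a then s else t) →
              (if a then x else 0) + (if b then y else 0) ≡ (if a then s else 0)
pair-sum-if {true}  (refl , x+y≡s) = x+y≡s
pair-sum-if {false} (refl , _)     = refl

pair-sum-if-not : ∀ {a b x y s t} → b ≡ a × x + y ≡ (if a then s else t) →
                  (if not a then x else 0) + (if not b then y else 0) ≡ (if not a then t else 0)
pair-sum-if-not {true}  (refl , _)     = refl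
pair-sum-if-not {false} (refl , x+y≡t) = x+y≡t

module _ (m : ℕ) where
  private
    k q : ℕ
    k = suc m
    q = suc k

  digitSumFuel-zero : ∀ f → digitSumFuel q f 0 ≡ 0
  digitSumFuel-zero zero    = refl
  digitSumFuel-zero (suc f) = digitSumFuel-zero f

  /q<q^ : ∀ f {n} → n < q ^ suc f → n / q < q ^ f
  /q<q^ f {n} n<q^1+f = m<n*o⇒m/o<n (subst (n <_) (*-comm q (q ^ f)) n<q^1+f)

  digitSumFuel-stable : ∀ a b {n} → n < q ^ a → n < q ^ b →
                        digitSumFuel q a n ≡ digitSumFuel q b n
  digitSumFuel-stable zero    b       (s≤s z≤n) _         = sym (digitSumFuel-zero b)
  digitSumFuel-stable (suc a) zero    _         (s≤s z≤n) = digitSumFuel-zero (suc a)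
  digitSumFuel-stable (suc a) (suc b) {n} n<q^a n<q^b =
    cong (n % q +_) (digitSumFuel-stable a b (/q<q^ a n<q^a) (/q<q^ b n<q^b))

  n<q^n : ∀ n → n < q ^ n
  n<q^n zero    = s≤s z≤n
  n<q^n (suc n) = begin-strict
    suc n             <⟨ +-mono-≤ (m^n>0 q n) (n<q^n n) ⟩
    q ^ n + q ^ n     ≤⟨ +-monoʳ-≤ (q ^ n) (m≤m+n (q ^ n) (m * q ^ n)) ⟩
    q ^ suc n         ∎
    where open ≤-Reasoning

  l≡digitSumFuel : ∀ d {n} → n < q ^ d → l q n ≡ digitSumFuel q d n
  l≡digitSumFuel d {n} = digitSumFuel-stable n d (n<q^n n)

  digitSumFuel-%-k : ∀ f {n} → n < q ^ f → digitSumFuel q f n % k ≡ n % k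
  digitSumFuel-%-k zero    (s≤s z≤n) = refl
  digitSumFuel-%-k (suc f) {n} n<q^1+f = begin
    (r + digitSumFuel q f t) % k              ≡⟨ %-distribˡ-+ r _ k ⟩
    (r % k + digitSumFuel q f t % k) % k      ≡⟨ cong (λ z → (r % k + z) % k)
                                                       (digitSumFuel-%-k f (/q<q^ f n<q^1+f)) ⟩
    (r % k + t % k) % k                       ≡⟨ sym (%-distribˡ-+ r t k) ⟩
    (r + t) % k                               ≡⟨ sym ([m+kn]%n≡m%n (r + t) t k) ⟩
    (r + t + t * k) % k                       ≡⟨ cong (_% k) (solve 3 (λ r t k → r :+ t :+ t :* k
                                                                   := r :+ t :* (con 1 :+ k)) refl r t k) ⟩
    (r + t * q) % k                           ≡⟨ cong (_% k) (sym (m≡m%n+[m/n]*n n q)) ⟩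
    n % k                                     ∎
    where
    open ≡-Reasoning
    r = n % q
    t = n / q

  l-%-k : ∀ n → l q n % k ≡ n % k
  l-%-k n = digitSumFuel-%-k n (n<q^n n)

  digitSumFuel-complement : ∀ d {n c} → suc (n + c) ≡ q ^ d →
                            digitSumFuel q d n + digitSumFuel q d c ≡ d * k
  digitSumFuel-complement zero    _ = refl
  digitSumFuel-complement (suc d) {n} {c} n+c+1≡q^1+d with carry q low-digits<2q digits
    where
    low-digits<2q : suc (n % q + c % q) < q + q
    low-digits<2q = subst (_< q + q) (+-suc (n % q) (c % q)) (+-mono-≤ (m%n<n n q) (m%n<n c q))
    digits : suc (n % q + c % q) + (n / q + c / q) * q ≡ q ^ d * q
    digits = begin
      suc (n % q + c % q) + (n / q + c / q) * q
        ≡⟨ solve 5 (λ a b x y z → (con 1 :+ (a :+ b)) :+ (x :+ y) :* z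
                                  := con 1 :+ ((a :+ x :* z) :+ (b :+ y :* z)))
                   refl (n % q) (c % q) (n / q) (c / q) q ⟩
      suc ((n % q + n / q * q) + (c % q + c / q * q))
        ≡⟨ cong₂ (λ x y → suc (x + y)) (sym (m≡m%n+[m/n]*n n q)) (sym (m≡m%n+[m/n]*n c q)) ⟩
      suc (n + c)
        ≡⟨ trans n+c+1≡q^1+d (*-comm q (q ^ d)) ⟩
      q ^ d * q
        ∎
      where open ≡-Reasoning
  ... | inj₁ (() , _)
  ... | inj₂ (low-digits≡q , high-part≡q^d) =
    trans (+-interchange (n % q) (digitSumFuel q d (n / q)) (c % q) (digitSumFuel q d (c / q)))
          (cong₂ _+_ (suc-injective low-digits≡q) (digitSumFuel-complement d high-part≡q^d))

  l-complement : ∀ d {n c} → suc (n + c) ≡ q ^ d → l q n + l q c ≡ d * k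
  l-complement d {n} {c} n+c+1≡q^d = begin
    l q n + l q c                                 ≡⟨ cong₂ _+_ (l≡digitSumFuel d n<q^d) (l≡digitSumFuel d c<q^d) ⟩
    digitSumFuel q d n + digitSumFuel q d c       ≡⟨ digitSumFuel-complement d n+c+1≡q^d ⟩
    d * k                                         ∎
    where
    open ≡-Reasoning
    n<q^d : n < q ^ d
    n<q^d = subst (n <_) n+c+1≡q^d (s≤s (m≤m+n n c))
    c<q^d : c < q ^ d
    c<q^d = subst (c <_) n+c+1≡q^d (s≤s (m≤n+m c n))

  isMultiple : ℕ → Bool
  isMultiple n = n % k ≡ᵇ 0

  ⌊l/k⌋ : ℕ → ℕ
  ⌊l/k⌋ n = l q n / k

  isMultiple-l : ∀ n → isMultiple (l q n) ≡ isMultiple n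
  isMultiple-l n = cong (_≡ᵇ 0) (l-%-k n)

  complement-floors : ∀ {d N n} → suc (suc N) ≡ q ^ d → n ≤ suc N →
    isMultiple (suc N ∸ n) ≡ isMultiple n
    × ⌊l/k⌋ n + ⌊l/k⌋ (suc N ∸ n) ≡ (if isMultiple n then d else d ∸ 1)
  complement-floors {d} {N} {n} N+2≡q^d n≤1+N
    with floor-sum-split k {d} {l q n} {l q (suc N ∸ n)} (l-complement d {n} {suc N ∸ n} n+c+1≡q^d)
    where
    n+c+1≡q^d : suc (n + (suc N ∸ n)) ≡ q ^ d
    n+c+1≡q^d = trans (cong suc (m+[n∸m]≡n n≤1+N)) N+2≡q^d
  ... | same-class , floors =
    trans (sym (isMultiple-l c)) (trans (sym same-class) (isMultiple-l n)) ,
    subst (λ b → ⌊l/k⌋ n + ⌊l/k⌋ c ≡ (if b then d else d ∸ 1)) (isMultiple-l n) floors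
    where c = suc N ∸ n

  twice-sum-multiples : ∀ {d N} → suc (suc N) ≡ q ^ d →
                        2 * sumFilt isMultiple ⌊l/k⌋ N ≡ sumFilt isMultiple (λ _ → d) N
  twice-sum-multiples {d} {N} N+2≡q^d = sumFilt-pairing _ _ _ N
    (λ {n} _ n≤N → pair-sum-if (complement-floors {d} {N} {n} N+2≡q^d (m≤n⇒m≤1+n n≤N)))

  twice-sum-nonMultiples : ∀ {d N} → suc (suc N) ≡ q ^ d →
                           2 * sumFilt (not ∘ isMultiple) ⌊l/k⌋ N
                           ≡ sumFilt (not ∘ isMultiple) (λ _ → d ∸ 1) N
  twice-sum-nonMultiples {d} {N} N+2≡q^d = sumFilt-pairing _ _ _ N
    (λ {n} _ n≤N → pair-sum-if-not (complement-floors {d} {N} {n} N+2≡q^d (m≤n⇒m≤1+n n≤N)))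

  isMultiple-residue : ∀ t r → r < k → isMultiple (r + t * k) ≡ (r ≡ᵇ 0)
  isMultiple-residue t r r<k = cong (_≡ᵇ 0) (trans ([m+kn]%n≡m%n r t k) (m<n⇒m%n≡m r<k))

  count-multiples : ∀ c t r → r ≤ m → sumFilt isMultiple (λ _ → c) (r + t * k) ≡ t * c
  count-multiples c zero    zero    _ = refl
  count-multiples c (suc t) zero    _ = begin
    sumFilt isMultiple (λ _ → c) (m + t * k) + (if isMultiple (suc t * k) then c else 0)
      ≡⟨ cong₂ _+_ (count-multiples c t m ≤-refl)
                   (cong (if_then c else 0) (isMultiple-residue (suc t) 0 (s≤s z≤n))) ⟩
    t * c + c
      ≡⟨ +-comm (t * c) c ⟩
    suc t * c ∎
    where open ≡-Reasoning
  count-multiples c t       (suc r) r<k rewrite isMultiple-residue t (suc r) (s≤s r<k) =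
    trans (+-identityʳ _) (count-multiples c t r (≤-trans (n≤1+n r) r<k))

  count-nonMultiples : ∀ c t r → r ≤ m →
                       sumFilt (not ∘ isMultiple) (λ _ → c) (r + t * k) ≡ (r + t * m) * c
  count-nonMultiples c zero    zero    _ = refl
  count-nonMultiples c (suc t) zero    _ =
    trans (cong₂ _+_ (count-nonMultiples c t m ≤-refl)
                     (cong (λ b → if not b then c else 0) (isMultiple-residue (suc t) 0 (s≤s z≤n))))
          (+-identityʳ _)
  count-nonMultiples c t       (suc r) r<k rewrite isMultiple-residue t (suc r) (s≤s r<k) =
    trans (cong (_+ c) (count-nonMultiples c t r (≤-trans (n≤1+n r) r<k))) (+-comm _ c)

  q^d≡2+m+T*k : ∀ {d} → 1 ≤ d → ∃[ T ] q ^ d ≡ suc (suc (m + T * k))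
  q^d≡2+m+T*k {suc zero}    _ = 0 , solve 1 (λ m → (con 2 :+ m) :* con 1 := con 2 :+ m :+ con 0) refl m
  q^d≡2+m+T*k {suc (suc d)} _ with q^d≡2+m+T*k {suc d} (s≤s z≤n)
  ... | T , q^d≡ = q * suc T , trans (cong (q *_) q^d≡)
    (solve 2 (λ m T → (con 2 :+ m) :* (con 2 :+ (m :+ T :* (con 1 :+ m)))
                      := con 2 :+ (m :+ ((con 2 :+ m) :* (con 1 :+ T)) :* (con 1 :+ m))) refl m T)

lemma3p1 : (m d : ℕ) → IsPrimePower (suc (suc m)) → 1 ≤ d →
    (2 * suc m * sumFilt (λ n → n % suc m ≡ᵇ 0) (λ n → l (suc (suc m)) n / suc m) (suc (suc m) ^ d ∸ 2)
       ≡ d * ((suc (suc m) ^ d ∸ 1) ∸ suc m))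
    × (2 * suc m * sumFilt (λ n → not (n % suc m ≡ᵇ 0)) (λ n → l (suc (suc m)) n / suc m) (suc (suc m) ^ d ∸ 2)
       ≡ (d ∸ 1) * m * (suc (suc m) ^ d ∸ 1))
-- The argument works in every base q ≥ 2.
lemma3p1 m d _ 1≤d with q^d≡2+m+T*k m 1≤d
... | T , q^d≡ rewrite q^d≡ = multiples , nonMultiples
  where
  open ≡-Reasoning
  k = suc m
  N = m + T * k
  2*k*s≡k*[2*s] : ∀ s → 2 * k * s ≡ k * (2 * s)
  2*k*s≡k*[2*s] s = trans (cong (_* s) (*-comm 2 k)) (*-assoc k 2 s)
  multiples : 2 * k * sumFilt (isMultiple m) (⌊l/k⌋ m) N ≡ d * (N ∸ m)
  multiples = begin
    2 * k * sumFilt (isMultiple m) (⌊l/k⌋ m) N   ≡⟨ 2*k*s≡k*[2*s] _ ⟩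
    k * (2 * sumFilt (isMultiple m) (⌊l/k⌋ m) N) ≡⟨ cong (k *_) (twice-sum-multiples m (sym q^d≡)) ⟩
    k * sumFilt (isMultiple m) (λ _ → d) N       ≡⟨ cong (k *_) (count-multiples m d T m ≤-refl) ⟩
    k * (T * d)                                  ≡⟨ solve 3 (λ k T d → k :* (T :* d) := d :* (T :* k)) refl k T d ⟩
    d * (T * k)                                  ≡⟨ cong (d *_) (sym (m+n∸m≡n m (T * k))) ⟩
    d * (N ∸ m)                                  ∎
  nonMultiples : 2 * k * sumFilt (not ∘ isMultiple m) (⌊l/k⌋ m) N ≡ (d ∸ 1) * m * suc N
  nonMultiples = begin
    2 * k * sumFilt (not ∘ isMultiple m) (⌊l/k⌋ m) N
      ≡⟨ 2*k*s≡k*[2*s] _ ⟩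
    k * (2 * sumFilt (not ∘ isMultiple m) (⌊l/k⌋ m) N)
      ≡⟨ cong (k *_) (twice-sum-nonMultiples m {d} (sym q^d≡)) ⟩
    k * sumFilt (not ∘ isMultiple m) (λ _ → d ∸ 1) N
      ≡⟨ cong (k *_) (count-nonMultiples m (d ∸ 1) T m ≤-refl) ⟩
    k * ((m + T * m) * (d ∸ 1))
      ≡⟨ solve 3 (λ m T e → (con 1 :+ m) :* ((m :+ T :* m) :* e)
                            := e :* m :* (con 1 :+ (m :+ T :* (con 1 :+ m)))) refl m T (d ∸ 1) ⟩
    (d ∸ 1) * m * suc N
      ∎
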